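{- Let $A=\{a_1,\dots,a_k\}$ be a set of $k\ge 4$ integers, and let $2h_1$ and $2h_2$ be the first and second $L^1$-minima of the coefficient lattice $\mathcal{L}$ of $A$. If $1\le h<h_1$, then \[|hA|=\binom{h+k-1}{k-1}.\] If $h_1\le h<h_2$, then \[|hA|=\binom{h+k-1}{k-1}-\binom{h-h_1+k-1}{k-1}.\]
   Context: For a finite set $A\subseteq\mathbb{Z}$ and a positive integer $h$, the $h$-fold sumset is $hA=\{x_1+\dots+x_h : x_i\in A\}$. Write $\vec a=\langle a_1,\dots,a_k\rangle$ and $\vec 1=\langle1,\dots,1\rangle\in\mathbb{Z}^k$. The coefficient lattice of $A$ is $\mathcal{L}=\{\vec c\in\mathbb{Z}^k:\vec c\cdot\vec 1=0,\ \vec c\cdot\vec a=0\}$ (of dimension $k-2$). For $i\ge1$, the $i$-th successive $L^1$-minimum of $\mathcal{L}$ is the infimum of those $\lambda$ such that $\{\vec c\in\mathcal{L}:\|\vec c\|_1\le\lambda\}$ contains $i$ linearly independent vectors; for this lattice these minima are even integers, denoted here $2h_1$ (first) and $2h_2$ (second). Binomial coefficients $\binom{n}{m}$ are taken to be $0$ when $n<m$. -}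

module Defs where

open import Data.Nat using (ℕ; zero; suc)
import Data.Nat as ℕ
open import Data.Integer using (ℤ; _+_; _*_; ∣_∣; 0ℤ; +_)
open import Data.Fin using (Fin)
open import Data.Product using (Σ; ∃; _×_)
open import Data.List using (List; length)
open import Data.List.Membership.Propositional using (_∈_)
open import Data.List.Relation.Unary.Unique.Propositional using (Unique)
open import Relation.Binary.PropositionalEquality using (_≡_)
open import Function.Bundles using (_⇔_)

Σℤ : {n : ℕ} → (Fin n → ℤ) → ℤ
Σℤ {zero}  f = 0ℤ
Σℤ {suc n} f = f Data.Fin.zero + Σℤ (λ i → f (Data.Fin.suc i))

Σℕ : {n : ℕ} → (Fin n → ℕ) → ℕ
Σℕ {zero}  f = 0
Σℕ {suc n} f = f Data.Fin.zero ℕ.+ Σℕ (λ i → f (Data.Fin.suc i))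

Vecℤ : ℕ → Set
Vecℤ k = Fin k → ℤ

_·_ : {k : ℕ} → Vecℤ k → Vecℤ k → ℤ
c · a = Σℤ (λ i → c i * a i)

‖_‖₁ : {k : ℕ} → Vecℤ k → ℕ
‖ c ‖₁ = Σℕ (λ i → ∣ c i ∣)

𝟙 : {k : ℕ} → Vecℤ k
𝟙 _ = + 1

InLattice : {k : ℕ} → Vecℤ k → Vecℤ k → Set
InLattice a c = (c · 𝟙 ≡ 0ℤ) × (c · a ≡ 0ℤ)

-- Linear independence of a family v₁,…,v_i of vectors in ℤ^k
-- (over ℤ, equivalently over ℚ): only the trivial integer combination vanishes.
LinIndep : {k i : ℕ} → (Fin i → Vecℤ k) → Set
LinIndep {k} {i} v =
  (r : Fin i → ℤ) → (∀ (t : Fin k) → Σℤ (λ j → r j * v j t) ≡ 0ℤ) →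
  ∀ (j : Fin i) → r j ≡ 0ℤ

HasIndepIn : {k : ℕ} → Vecℤ k → (i : ℕ) → ℕ → Set
HasIndepIn {k} a i λ′ =
  Σ (Fin i → Vecℤ k) λ v →
    LinIndep v × (∀ j → InLattice a (v j)) × (∀ j → ‖ v j ‖₁ ℕ.≤ λ′)

-- λ′ is the i-th successive L¹-minimum of the coefficient lattice of a:
-- the least λ such that the ball of radius λ contains i linearly independent
-- lattice vectors (norms are integers, so the infimum is attained).
IsSuccMin : {k : ℕ} → Vecℤ k → (i : ℕ) → ℕ → Set
IsSuccMin a i λ′ = HasIndepIn a i λ′ × (∀ μ → HasIndepIn a i μ → λ′ ℕ.≤ μ)

InSumset : {k : ℕ} → Vecℤ k → ℕ → ℤ → Set
InSumset {k} a h x = ∃ λ (f : Fin h → Fin k) → x ≡ Σℤ (λ j → a (f j))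

HasCard : (ℤ → Set) → ℕ → Set
HasCard P n = Σ (List ℤ) λ xs → Unique xs × (length xs ≡ n) × (∀ x → (x ∈ xs) ⇔ P x)

module Submission where

-- An element of hA is the value Σ mᵢ aᵢ of a multiplicity vector m ∈ ℕᵏ with ∣m∣ = h, and there
-- are C(h+k-1, k-1) such m.  Two of them with the same value differ by a lattice vector of L¹-norm
-- at most 2h, so for h < h₁ they coincide.  For h₁ ≤ h < h₂, write a shortest lattice vector as
-- v = v⁺ - v⁻ with ∣v⁺∣ = ∣v⁻∣ = h₁.  As 2h < 2h₂, such a difference must be an integer multiple of
-- v, so no two vectors with v⁺ ≰ m share a value; and every m ≥ v⁺ can be traded for m - v⁺ + v⁻ without
-- changing ∣m∣ or the value.  Hence hA is in bijection with the m not dominating v⁺, and the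
-- C(h-h₁+k-1, k-1) vectors dominating v⁺ are exactly v⁺ plus a vector of size h - h₁.

open import Defs
open import Data.Empty using (⊥-elim)
open import Data.Fin using (Fin) renaming (zero to fzero; suc to fsuc)
import Data.Fin.Properties as Fin
open import Data.Integer as ℤ using (ℤ; -[1+_]; 0ℤ; 1ℤ; ∣_∣)
import Data.Integer.DivMod as ℤ
import Data.Integer.Properties as ℤ
open import Data.Integer.Tactic.RingSolver using (solve-∀)
open import Data.List using (List; []; _∷_; [_]; _++_; map; length; filter)
open import Data.List.Membership.Propositional using (_∈_)
open import Data.List.Membership.Propositional.Properties
  using (∈-map⁺; ∈-map⁻; ∈-++⁺ˡ; ∈-++⁺ʳ; ∈-++⁻; ∈-filter⁺; ∈-filter⁻)
open import Data.List.Membership.Propositional.Properties.WithK using (unique∧set⇒bag)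
open import Data.List.Properties using (length-map; length-++)
open import Data.List.Relation.Binary.BagAndSetEquality using (∼bag⇒↭)
open import Data.List.Relation.Binary.Permutation.Propositional.Properties using (↭-length)
open import Data.List.Relation.Unary.All as All using ([])
import Data.List.Relation.Unary.All.Properties as All
open import Data.List.Relation.Unary.AllPairs using ([]; _∷_)
open import Data.List.Relation.Unary.Any using (here; there)
open import Data.List.Relation.Unary.Unique.Propositional using (Unique)
import Data.List.Relation.Unary.Unique.Propositional.Properties as Unique
open import Data.Nat using (ℕ; zero; suc; _≤_; _<_; _+_; _∸_; _*_; z≤n; s≤s; _≤?_; NonZero; >-nonZero)
open import Data.Nat.Combinatorics using (_C_; nCn≡1; nCk+nC[k+1]≡[n+1]C[k+1])
import Data.Nat.Properties as ℕ
open import Data.Product using (Σ; ∃; _×_; _,_; proj₁; proj₂)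
open import Data.Sum using (inj₁; inj₂)
open import Data.Vec using (Vec; []; _∷_; lookup; replicate; updateAt; tabulate; zipWith; sum)
open import Data.Vec.Properties using (lookup∘tabulate; ∷-injectiveˡ; ∷-injectiveʳ)
open import Data.Vec.Relation.Binary.Pointwise.Inductive as Pointwise using (Pointwise; []; _∷_)
open import Function using (_∘_)
open import Function.Bundles using (_⇔_; mk⇔; Equivalence)
open import Function.Definitions using (Injective)
open import Relation.Binary.PropositionalEquality
  using (_≡_; _≢_; refl; sym; trans; cong; cong₂; subst; module ≡-Reasoning)
open import Relation.Nullary using (¬_; Dec; yes; no)
open import Relation.Nullary.Decidable using (¬?)
open import Algebra.Properties.AbelianGroup ℤ.+-0-abelianGroup
  using () renaming (∙-cancelʳ to +ℤ-cancelʳ)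
open import Algebra.Properties.CommutativeSemigroup ℕ.+-commutativeSemigroup
  using () renaming (interchange to +-interchange)
open import Algebra.Properties.CommutativeSemigroup ℤ.+-commutativeSemigroup
  using () renaming (interchange to +ℤ-interchange)

open ≡-Reasoning

Σℤ-cong : ∀ {k} {f g : Fin k → ℤ} → (∀ i → f i ≡ g i) → Σℤ f ≡ Σℤ g
Σℤ-cong {zero}  f≡g = refl
Σℤ-cong {suc k} f≡g = cong₂ ℤ._+_ (f≡g fzero) (Σℤ-cong (f≡g ∘ fsuc))

Σℕ-cong : ∀ {k} {f g : Fin k → ℕ} → (∀ i → f i ≡ g i) → Σℕ f ≡ Σℕ g
Σℕ-cong {zero}  f≡g = refl
Σℕ-cong {suc k} f≡g = cong₂ _+_ (f≡g fzero) (Σℕ-cong (f≡g ∘ fsuc))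

≤-Σℕ : ∀ {k} (f : Fin k → ℕ) t → f t ≤ Σℕ f
≤-Σℕ f fzero    = ℕ.m≤m+n _ _
≤-Σℕ f (fsuc t) = ℕ.≤-trans (≤-Σℕ (f ∘ fsuc) t) (ℕ.m≤n+m _ _)

Σℕ-*ˡ : ∀ {k} c (f : Fin k → ℕ) → Σℕ (λ i → c * f i) ≡ c * Σℕ f
Σℕ-*ˡ {zero}  c f = sym (ℕ.*-zeroʳ c)
Σℕ-*ˡ {suc k} c f = trans (cong ((c * f fzero) +_) (Σℕ-*ˡ c (f ∘ fsuc))) (sym (ℕ.*-distribˡ-+ c _ _))

‖*‖₁ : ∀ {k} c (w : Vecℤ k) → ‖ (λ i → c ℤ.* w i) ‖₁ ≡ ∣ c ∣ * ‖ w ‖₁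
‖*‖₁ c w = trans (Σℕ-cong (λ i → ℤ.abs-* c (w i))) (Σℕ-*ˡ ∣ c ∣ (λ i → ∣ w i ∣))

0<‖‖₁ : ∀ {k} (w : Vecℤ k) t → w t ≢ 0ℤ → 0 < ‖ w ‖₁
0<‖‖₁ w t wt≢0 with ∣ w t ∣ in eq | ≤-Σℕ (λ i → ∣ w i ∣) t
... | zero  | _     = ⊥-elim (wt≢0 (ℤ.∣i∣≡0⇒i≡0 eq))
... | suc _ | wt≤‖w‖ = ℕ.≤-trans (s≤s z≤n) wt≤‖w‖

·-sub-* : ∀ {k} (d v c : Vecℤ k) q →
  (λ i → d i ℤ.- q ℤ.* v i) · c ≡ d · c ℤ.- q ℤ.* (v · c)
·-sub-* {zero}  d v c q = sym (cong (λ x → 0ℤ ℤ.- x) (ℤ.*-zeroʳ q))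
·-sub-* {suc k} d v c q = begin
  (d₀ ℤ.- q ℤ.* v₀) ℤ.* c₀ ℤ.+ (λ i → d (fsuc i) ℤ.- q ℤ.* v (fsuc i)) · (c ∘ fsuc)
    ≡⟨ cong (λ x → (d₀ ℤ.- q ℤ.* v₀) ℤ.* c₀ ℤ.+ x) (·-sub-* (d ∘ fsuc) (v ∘ fsuc) (c ∘ fsuc) q) ⟩
  (d₀ ℤ.- q ℤ.* v₀) ℤ.* c₀ ℤ.+ ((d ∘ fsuc) · (c ∘ fsuc) ℤ.- q ℤ.* ((v ∘ fsuc) · (c ∘ fsuc)))
    ≡⟨ ring d₀ v₀ c₀ q _ _ ⟩
  (d₀ ℤ.* c₀ ℤ.+ (d ∘ fsuc) · (c ∘ fsuc)) ℤ.- q ℤ.* (v₀ ℤ.* c₀ ℤ.+ (v ∘ fsuc) · (c ∘ fsuc)) ∎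
  where
  d₀ v₀ c₀ : ℤ
  d₀ = d fzero
  v₀ = v fzero
  c₀ = c fzero
  ring : ∀ d v c q x y → (d ℤ.- q ℤ.* v) ℤ.* c ℤ.+ (x ℤ.- q ℤ.* y) ≡ (d ℤ.* c ℤ.+ x) ℤ.- q ℤ.* (v ℤ.* c ℤ.+ y)
  ring = solve-∀

InLattice-sub-* : ∀ {k} (a d v : Vecℤ k) q → InLattice a d → InLattice a v →
  InLattice a (λ i → d i ℤ.- q ℤ.* v i)
InLattice-sub-* a d v q (d·𝟙≡0 , d·a≡0) (v·𝟙≡0 , v·a≡0) =
  vanish 𝟙 d·𝟙≡0 v·𝟙≡0 , vanish a d·a≡0 v·a≡0
  where
  vanish : ∀ c → d · c ≡ 0ℤ → v · c ≡ 0ℤ → (λ i → d i ℤ.- q ℤ.* v i) · c ≡ 0ℤ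
  vanish c d·c≡0 v·c≡0 = begin
    (λ i → d i ℤ.- q ℤ.* v i) · c ≡⟨ ·-sub-* d v c q ⟩
    d · c ℤ.- q ℤ.* (v · c)       ≡⟨ cong₂ (λ x y → x ℤ.- q ℤ.* y) d·c≡0 v·c≡0 ⟩
    0ℤ ℤ.- q ℤ.* 0ℤ               ≡⟨ cong (λ x → 0ℤ ℤ.- x) (ℤ.*-zeroʳ q) ⟩
    0ℤ                            ∎

positive-half : ∀ h → 0 < 2 * h → 0 < h
positive-half (suc _) _ = s≤s z≤n

single-linIndep : ∀ {k} (w : Vecℤ k) t → w t ≢ 0ℤ → LinIndep (λ (_ : Fin 1) → w)
single-linIndep w t wt≢0 r rw≡0 fzero
  with ℤ.i*j≡0⇒i≡0∨j≡0 (r fzero) (trans (sym (ℤ.+-identityʳ _)) (rw≡0 t))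
... | inj₁ r≡0  = r≡0
... | inj₂ wt≡0 = ⊥-elim (wt≢0 wt≡0)

-- Multiplicity vectors and the sumset

eval : ∀ {k} → Vec ℕ k → Vecℤ k → ℤ
eval []      a = 0ℤ
eval (x ∷ m) a = ℤ.+ x ℤ.* a fzero ℤ.+ eval m (a ∘ fsuc)

eval-𝟙 : ∀ {k} (m : Vec ℕ k) → eval m 𝟙 ≡ ℤ.+ sum m
eval-𝟙 []      = refl
eval-𝟙 (x ∷ m) = trans (cong₂ ℤ._+_ (ℤ.*-identityʳ (ℤ.+ x)) (eval-𝟙 m)) (sym (ℤ.pos-+ x (sum m)))

eval-replicate-0 : ∀ k (a : Vecℤ k) → eval (replicate k 0) a ≡ 0ℤ
eval-replicate-0 zero    a = refl
eval-replicate-0 (suc k) a = trans (ℤ.+-identityˡ _) (eval-replicate-0 k (a ∘ fsuc))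

sum-replicate-0 : ∀ k → sum (replicate k 0) ≡ 0
sum-replicate-0 zero    = refl
sum-replicate-0 (suc k) = sum-replicate-0 k

sum-updateAt-suc : ∀ {k} (m : Vec ℕ k) i → sum (updateAt m i suc) ≡ suc (sum m)
sum-updateAt-suc (x ∷ m) fzero    = refl
sum-updateAt-suc (x ∷ m) (fsuc i) = trans (cong (x +_) (sum-updateAt-suc m i)) (ℕ.+-suc x (sum m))

eval-updateAt-suc : ∀ {k} (m : Vec ℕ k) i (a : Vecℤ k) →
  eval (updateAt m i suc) a ≡ a i ℤ.+ eval m a
eval-updateAt-suc (x ∷ m) fzero a = ring (a fzero) (ℤ.+ x) (eval m (a ∘ fsuc))
  where
  ring : ∀ z x w → (1ℤ ℤ.+ x) ℤ.* z ℤ.+ w ≡ z ℤ.+ (x ℤ.* z ℤ.+ w)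
  ring = solve-∀
eval-updateAt-suc (x ∷ m) (fsuc i) a = begin
  ℤ.+ x ℤ.* a fzero ℤ.+ eval (updateAt m i suc) (a ∘ fsuc)
    ≡⟨ cong (λ e → ℤ.+ x ℤ.* a fzero ℤ.+ e) (eval-updateAt-suc m i (a ∘ fsuc)) ⟩
  ℤ.+ x ℤ.* a fzero ℤ.+ (a (fsuc i) ℤ.+ eval m (a ∘ fsuc))
    ≡⟨ ring (ℤ.+ x ℤ.* a fzero) (a (fsuc i)) _ ⟩
  a (fsuc i) ℤ.+ (ℤ.+ x ℤ.* a fzero ℤ.+ eval m (a ∘ fsuc)) ∎
  where
  ring : ∀ u v w → u ℤ.+ (v ℤ.+ w) ≡ v ℤ.+ (u ℤ.+ w)
  ring = solve-∀

tally : ∀ {h k} → (Fin h → Fin k) → Vec ℕ k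
tally {zero}  f = replicate _ 0
tally {suc h} f = updateAt (tally (f ∘ fsuc)) (f fzero) suc

sum-tally : ∀ {h k} (f : Fin h → Fin k) → sum (tally f) ≡ h
sum-tally {zero} {k} f = sum-replicate-0 k
sum-tally {suc h} f = trans (sum-updateAt-suc (tally (f ∘ fsuc)) (f fzero)) (cong suc (sum-tally (f ∘ fsuc)))

eval-tally : ∀ {h k} (f : Fin h → Fin k) (a : Vecℤ k) → eval (tally f) a ≡ Σℤ (a ∘ f)
eval-tally {zero} {k} f a = eval-replicate-0 k a
eval-tally {suc h} f a = trans (eval-updateAt-suc (tally (f ∘ fsuc)) (f fzero) a)
                               (cong (λ e → a (f fzero) ℤ.+ e) (eval-tally (f ∘ fsuc) a))

word : ∀ {k} (m : Vec ℕ k) (a : Vecℤ k) → Σ (Fin (sum m) → Fin k) λ f → Σℤ (a ∘ f) ≡ eval m a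
word []          a = (λ ()) , refl
word (zero  ∷ m) a with word m (a ∘ fsuc)
... | f , Σaf≡ = fsuc ∘ f , trans Σaf≡ (sym (ℤ.+-identityˡ _))
word (suc x ∷ m) a with word (x ∷ m) a
... | f , Σaf≡ = (λ { fzero → fzero ; (fsuc j) → f j })
               , trans (cong (λ e → a fzero ℤ.+ e) Σaf≡)
                       (sym (eval-updateAt-suc (x ∷ m) fzero a))

suc-head : ∀ {k} → Vec ℕ (suc k) → Vec ℕ (suc k)
suc-head (x ∷ m) = suc x ∷ m

compositions : (k h : ℕ) → List (Vec ℕ k)
compositions zero    zero    = [ [] ]
compositions zero    (suc h) = []
compositions (suc k) zero    = map (0 ∷_) (compositions k zero)
compositions (suc k) (suc h) =
  map suc-head (compositions (suc k) h) ++ map (0 ∷_) (compositions k (suc h))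

sum-compositions : ∀ k h {m : Vec ℕ k} → m ∈ compositions k h → sum m ≡ h
sum-compositions zero    zero    (here refl) = refl
sum-compositions (suc k) zero    m∈ with ∈-map⁻ (0 ∷_) m∈
... | _ , m′∈ , refl = sum-compositions k zero m′∈
sum-compositions (suc k) (suc h) m∈ with ∈-++⁻ (map suc-head (compositions (suc k) h)) m∈
... | inj₁ m∈ˡ with ∈-map⁻ suc-head m∈ˡ
...   | (_ ∷ _) , m′∈ , refl = cong suc (sum-compositions (suc k) h m′∈)
sum-compositions (suc k) (suc h) m∈ | inj₂ m∈ʳ with ∈-map⁻ (0 ∷_) m∈ʳ
...   | _ , m′∈ , refl = sum-compositions k (suc h) m′∈

∈-compositions : ∀ {k h} {m : Vec ℕ k} → sum m ≡ h → m ∈ compositions k h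
∈-compositions {m = m} refl = ∈-compositions-sum m
  where
  ∈-compositions-sum : ∀ {k} (m : Vec ℕ k) → m ∈ compositions k (sum m)
  ∈-compositions-sum []          = here refl
  ∈-compositions-sum (zero ∷ m) with sum m | ∈-compositions-sum m
  ... | zero  | m∈ = ∈-map⁺ (0 ∷_) m∈
  ... | suc s | m∈ = ∈-++⁺ʳ (map suc-head (compositions _ s)) (∈-map⁺ (0 ∷_) m∈)
  ∈-compositions-sum (suc x ∷ m) = ∈-++⁺ˡ (∈-map⁺ suc-head (∈-compositions-sum (x ∷ m)))

compositions-unique : ∀ k h → Unique (compositions k h)
compositions-unique zero    zero    = [] ∷ []
compositions-unique zero    (suc h) = []
compositions-unique (suc k) zero    = Unique.map⁺ ∷-injectiveʳ (compositions-unique k zero)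
compositions-unique (suc k) (suc h) =
  Unique.++⁺ (Unique.map⁺ suc-head-injective (compositions-unique (suc k) h))
             (Unique.map⁺ ∷-injectiveʳ (compositions-unique k (suc h)))
             disjoint
  where
  suc-head-injective : ∀ {m m′ : Vec ℕ (suc k)} → suc-head m ≡ suc-head m′ → m ≡ m′
  suc-head-injective {_ ∷ _} {_ ∷ _} refl = refl
  disjoint : ∀ {m} → ¬ (m ∈ map suc-head (compositions (suc k) h) × m ∈ map (0 ∷_) (compositions k (suc h)))
  disjoint (m∈ˡ , m∈ʳ) with ∈-map⁻ suc-head m∈ˡ | ∈-map⁻ (0 ∷_) m∈ʳ
  ... | (_ ∷ _) , _ , refl | _ , _ , ()

length-compositions : ∀ k h → length (compositions (suc k) h) ≡ (h + k) C k
length-compositions zero    zero    = refl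
length-compositions (suc k) zero    =
  trans (length-map (0 ∷_) (compositions (suc k) zero))
        (trans (length-compositions k zero) (trans (nCn≡1 k) (sym (nCn≡1 (suc k)))))
length-compositions zero    (suc h) = begin
  length (map suc-head (compositions 1 h) ++ []) ≡⟨ length-++ (map suc-head (compositions 1 h)) ⟩
  length (map suc-head (compositions 1 h)) + 0   ≡⟨ ℕ.+-identityʳ _ ⟩
  length (map suc-head (compositions 1 h))       ≡⟨ length-map suc-head (compositions 1 h) ⟩
  length (compositions 1 h)                      ≡⟨ length-compositions zero h ⟩
  1                                              ∎
length-compositions (suc k) (suc h) = begin
  length (map suc-head (compositions (suc (suc k)) h) ++ map (0 ∷_) (compositions (suc k) (suc h)))
    ≡⟨ length-++ (map suc-head (compositions (suc (suc k)) h)) ⟩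
  length (map suc-head (compositions (suc (suc k)) h)) + length (map (0 ∷_) (compositions (suc k) (suc h)))
    ≡⟨ cong₂ _+_ (length-map suc-head (compositions (suc (suc k)) h)) (length-map (0 ∷_) (compositions (suc k) (suc h))) ⟩
  length (compositions (suc (suc k)) h) + length (compositions (suc k) (suc h))
    ≡⟨ cong₂ _+_ (length-compositions (suc k) h) (length-compositions k (suc h)) ⟩
  (h + suc k) C suc k + (suc h + k) C k
    ≡⟨ cong (λ n → n C suc k + (suc h + k) C k) (ℕ.+-suc h k) ⟩
  (suc h + k) C suc k + (suc h + k) C k
    ≡⟨ ℕ.+-comm ((suc h + k) C suc k) _ ⟩
  (suc h + k) C k + (suc h + k) C suc k
    ≡⟨ nCk+nC[k+1]≡[n+1]C[k+1] (suc h + k) k ⟩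
  suc (suc h + k) C suc k
    ≡⟨ cong (λ n → suc n C suc k) (sym (ℕ.+-suc h k)) ⟩
  (suc h + suc k) C suc k ∎

InSumset⇔composition : ∀ {k} (a : Vecℤ k) h z →
  InSumset a h z ⇔ (∃ λ m → m ∈ compositions k h × z ≡ eval m a)
InSumset⇔composition {k} a h z = mk⇔ to from
  where
  to : InSumset a h z → ∃ λ m → m ∈ compositions k h × z ≡ eval m a
  to (f , z≡) = tally f
              , ∈-compositions (sum-tally f)
              , trans z≡ (sym (eval-tally f a))
  from : (∃ λ m → m ∈ compositions k h × z ≡ eval m a) → InSumset a h z
  from (m , m∈ , refl) with refl ← sum-compositions k h m∈ = let (f , Σaf≡) = word m a in f , sym Σaf≡

-- Collisions give short lattice vectors

diff : ∀ {k} → Vec ℕ k → Vec ℕ k → Vecℤ k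
diff m m′ i = ℤ.+ lookup m i ℤ.- ℤ.+ lookup m′ i

diff-· : ∀ {k} (m m′ : Vec ℕ k) (c : Vecℤ k) → diff m m′ · c ≡ eval m c ℤ.- eval m′ c
diff-· []      []        c = refl
diff-· (x ∷ m) (x′ ∷ m′) c =
  trans (cong (λ e → (ℤ.+ x ℤ.- ℤ.+ x′) ℤ.* c fzero ℤ.+ e) (diff-· m m′ (c ∘ fsuc)))
        (ring (ℤ.+ x) (ℤ.+ x′) (c fzero) _ _)
  where
  ring : ∀ x x′ c e e′ → (x ℤ.- x′) ℤ.* c ℤ.+ (e ℤ.- e′) ≡ (x ℤ.* c ℤ.+ e) ℤ.- (x′ ℤ.* c ℤ.+ e′)
  ring = solve-∀

diff-InLattice : ∀ {k} (a : Vecℤ k) (m m′ : Vec ℕ k) →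
  sum m ≡ sum m′ → eval m a ≡ eval m′ a → InLattice a (diff m m′)
diff-InLattice a m m′ sum≡ eval≡ =
  trans (diff-· m m′ 𝟙) (ℤ.i≡j⇒i-j≡0 (trans (eval-𝟙 m) (trans (cong ℤ.+_ sum≡) (sym (eval-𝟙 m′))))) ,
  trans (diff-· m m′ a) (ℤ.i≡j⇒i-j≡0 eval≡)

‖diff‖₁≤ : ∀ {k} (m m′ : Vec ℕ k) → ‖ diff m m′ ‖₁ ≤ sum m + sum m′
‖diff‖₁≤ []      []        = z≤n
‖diff‖₁≤ (x ∷ m) (x′ ∷ m′) = ℕ.≤-trans
  (ℕ.+-mono-≤ (ℤ.∣i-j∣≤∣i∣+∣j∣ (ℤ.+ x) (ℤ.+ x′)) (‖diff‖₁≤ m m′))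
  (ℕ.≤-reflexive (+-interchange x x′ (sum m) (sum m′)))

‖diff‖₁≤2* : ∀ {k h} (m m′ : Vec ℕ k) → sum m ≡ h → sum m′ ≡ h → ‖ diff m m′ ‖₁ ≤ 2 * h
‖diff‖₁≤2* {h = h} m m′ sum≡ sum′≡ = ℕ.≤-trans (‖diff‖₁≤ m m′) (ℕ.≤-reflexive (begin
  sum m + sum m′ ≡⟨ cong₂ _+_ sum≡ sum′≡ ⟩
  h + h          ≡⟨ cong (h +_) (sym (ℕ.+-identityʳ h)) ⟩
  2 * h          ∎))

diff-nonzero : ∀ {k} {m m′ : Vec ℕ k} → m ≢ m′ → ∃ λ t → diff m m′ t ≢ 0ℤ
diff-nonzero {m = []}    {[]}      m≢m′ = ⊥-elim (m≢m′ refl)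
diff-nonzero {m = x ∷ m} {x′ ∷ m′} m≢m′ with x ℕ.≟ x′
... | no x≢x′    = fzero , x≢x′ ∘ ℤ.+-injective ∘ ℤ.i-j≡0⇒i≡j (ℤ.+ x) (ℤ.+ x′)
... | yes refl with diff-nonzero (m≢m′ ∘ cong (x ∷_))
...   | t , d≢0 = fsuc t , d≢0

diff-swap : ∀ {k} (m m′ : Vec ℕ k) t → diff m′ m t ≡ ℤ.- diff m m′ t
diff-swap m m′ t = ring (ℤ.+ lookup m t) (ℤ.+ lookup m′ t)
  where
  ring : ∀ x x′ → x′ ℤ.- x ≡ ℤ.- (x ℤ.- x′)
  ring = solve-∀

collision⇒HasIndepIn : ∀ {k h} (a : Vecℤ k) {m m′ : Vec ℕ k} → sum m ≡ h → sum m′ ≡ h →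
  m ≢ m′ → eval m a ≡ eval m′ a → HasIndepIn a 1 (2 * h)
collision⇒HasIndepIn a {m} {m′} sum≡ sum′≡ m≢m′ eval≡ =
  let (t , d≢0) = diff-nonzero m≢m′ in
  (λ _ → diff m m′) , single-linIndep (diff m m′) t d≢0 ,
  (λ _ → diff-InLattice a m m′ (trans sum≡ (sym sum′≡)) eval≡) , (λ _ → ‖diff‖₁≤2* m m′ sum≡ sum′≡)

hasCard-image : ∀ {A : Set} {P : ℤ → Set} (g : A → ℤ) (xs : List A) → Unique xs →
  (∀ {x y} → x ∈ xs → y ∈ xs → x ≢ y → g x ≢ g y) →
  (∀ z → P z ⇔ (∃ λ x → x ∈ xs × z ≡ g x)) → HasCard P (length xs)
hasCard-image g xs xs-unique g-injective P⇔ =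
  map g xs , map-unique xs xs-unique g-injective , length-map g xs ,
  λ z → mk⇔ (λ z∈ → Equivalence.from (P⇔ z) (∈-map⁻ g z∈))
            (λ Pz → let (x , x∈ , z≡) = Equivalence.to (P⇔ z) Pz in subst (_∈ map g xs) (sym z≡) (∈-map⁺ g x∈))
  where
  map-unique : ∀ ys → Unique ys → (∀ {x y} → x ∈ ys → y ∈ ys → x ≢ y → g x ≢ g y) → Unique (map g ys)
  map-unique []       []                  _     = []
  map-unique (y ∷ ys) (y∉ys ∷ ys-unique) g-inj =
    All.map⁺ (All.tabulate (λ y′∈ → g-inj (here refl) (there y′∈) (All.lookup y∉ys y′∈)))
    ∷ map-unique ys ys-unique (λ x∈ y∈ → g-inj (there x∈) (there y∈))

card-below-h₁ : ∀ {k h₁} (a : Vecℤ k) → IsSuccMin a 1 (2 * h₁) →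
  ∀ {h} → h < h₁ → HasCard (InSumset a h) (length (compositions k h))
card-below-h₁ {k} a (_ , minimal) {h} h<h₁ =
  hasCard-image (λ m → eval m a) (compositions k h) (compositions-unique k h) distinct
                (InSumset⇔composition a h)
  where
  distinct : ∀ {m m′} → m ∈ compositions k h → m′ ∈ compositions k h → m ≢ m′ → eval m a ≢ eval m′ a
  distinct m∈ m′∈ m≢m′ eval≡ = ℕ.<⇒≱ (ℕ.*-monoʳ-< 2 h<h₁)
    (minimal (2 * h) (collision⇒HasIndepIn a (sum-compositions k h m∈) (sum-compositions k h m′∈) m≢m′ eval≡))

posPart negPart : ℤ → ℕ
posPart (ℤ.+ n)  = n
posPart -[1+ n ] = 0
negPart (ℤ.+ n)  = 0
negPart -[1+ n ] = suc n

posPart-negPart : ∀ z → ℤ.+ posPart z ℤ.- ℤ.+ negPart z ≡ z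
posPart-negPart (ℤ.+ n)  = ℤ.+-identityʳ (ℤ.+ n)
posPart-negPart -[1+ n ] = refl

∣∣≡posPart+negPart : ∀ z → ∣ z ∣ ≡ posPart z + negPart z
∣∣≡posPart+negPart (ℤ.+ n)  = sym (ℕ.+-identityʳ n)
∣∣≡posPart+negPart -[1+ n ] = refl

posPart*negPart≡0 : ∀ z → posPart z * negPart z ≡ 0
posPart*negPart≡0 (ℤ.+ n)  = ℕ.*-zeroʳ n
posPart*negPart≡0 -[1+ n ] = refl

posParts negParts : ∀ {k} → Vecℤ k → Vec ℕ k
posParts v = tabulate (posPart ∘ v)
negParts v = tabulate (negPart ∘ v)

diff-posParts-negParts : ∀ {k} (v : Vecℤ k) t → diff (posParts v) (negParts v) t ≡ v t
diff-posParts-negParts v t =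
  trans (cong₂ (λ x y → ℤ.+ x ℤ.- ℤ.+ y) (lookup∘tabulate (posPart ∘ v) t) (lookup∘tabulate (negPart ∘ v) t))
        (posPart-negPart (v t))

·-posParts-negParts : ∀ {k} (v c : Vecℤ k) → v · c ≡ eval (posParts v) c ℤ.- eval (negParts v) c
·-posParts-negParts v c =
  trans (Σℤ-cong (λ t → cong (ℤ._* c t) (sym (diff-posParts-negParts v t))))
        (diff-· (posParts v) (negParts v) c)

‖‖₁≡sum-posParts+sum-negParts : ∀ {k} (v : Vecℤ k) → ‖ v ‖₁ ≡ sum (posParts v) + sum (negParts v)
‖‖₁≡sum-posParts+sum-negParts {zero}  v = refl
‖‖₁≡sum-posParts+sum-negParts {suc k} v =
  trans (cong₂ _+_ (∣∣≡posPart+negPart (v fzero)) (‖‖₁≡sum-posParts+sum-negParts (v ∘ fsuc)))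
        (+-interchange (posPart (v fzero)) (negPart (v fzero)) _ _)

posParts*negParts≡0 : ∀ {k} (v : Vecℤ k) → Pointwise (λ x y → x * y ≡ 0) (posParts v) (negParts v)
posParts*negParts≡0 {zero}  v = []
posParts*negParts≡0 {suc k} v = posPart*negPart≡0 (v fzero) ∷ posParts*negParts≡0 (v ∘ fsuc)

infix 4 _≼_ _≼?_

_≼_ : ∀ {k} → Vec ℕ k → Vec ℕ k → Set
_≼_ = Pointwise _≤_

_≼?_ : ∀ {k} (p m : Vec ℕ k) → Dec (p ≼ m)
_≼?_ = Pointwise.decidable _≤?_

multiple⇒posParts≼ : ∀ {k} (v : Vecℤ k) (r r′ : Vec ℕ k) q →
  (∀ t → diff r r′ t ≡ ℤ.+ suc q ℤ.* v t) → posParts v ≼ r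
multiple⇒posParts≼ v []      []        q r-r′≡ = []
multiple⇒posParts≼ v (x ∷ r) (x′ ∷ r′) q r-r′≡ =
  posPart≤ (v fzero) (r-r′≡ fzero) ∷ multiple⇒posParts≼ (v ∘ fsuc) r r′ q (r-r′≡ ∘ fsuc)
  where
  posPart≤ : ∀ z → ℤ.+ x ℤ.- ℤ.+ x′ ≡ ℤ.+ suc q ℤ.* z → posPart z ≤ x
  posPart≤ -[1+ _ ] _   = z≤n
  posPart≤ (ℤ.+ c)  x-x′≡ = subst (c ≤_) (sym x≡) (ℕ.≤-trans (ℕ.m≤n*m c (suc q)) (ℕ.m≤n+m _ x′))
    where
    x≡ : x ≡ x′ + suc q * c
    x≡ = ℤ.+-injective (begin
      ℤ.+ x                                 ≡⟨ ring (ℤ.+ x) (ℤ.+ x′) ⟩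
      ℤ.+ x′ ℤ.+ (ℤ.+ x ℤ.- ℤ.+ x′)          ≡⟨ cong (λ e → ℤ.+ x′ ℤ.+ e) (trans x-x′≡ (sym (ℤ.pos-* (suc q) c))) ⟩
      ℤ.+ x′ ℤ.+ ℤ.+ (suc q * c)             ≡⟨ sym (ℤ.pos-+ x′ (suc q * c)) ⟩
      ℤ.+ (x′ + suc q * c)                  ∎)
      where
      ring : ∀ x x′ → x ≡ x′ ℤ.+ (x ℤ.- x′)
      ring = solve-∀

-- Exchanges preserving size and value

exchange : ∀ {k} → Vec ℕ k → Vec ℕ k → Vec ℕ k → Vec ℕ k
exchange []      []      []      = []
exchange (x ∷ p) (y ∷ n) (z ∷ m) = z ∸ x + y ∷ exchange p n m

∸+-exchange : ∀ {x z} y → x ≤ z → z ∸ x + y + x ≡ z + y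
∸+-exchange {x} {z} y x≤z = begin
  z ∸ x + y + x   ≡⟨ ℕ.+-assoc (z ∸ x) y x ⟩
  z ∸ x + (y + x) ≡⟨ cong (z ∸ x +_) (ℕ.+-comm y x) ⟩
  z ∸ x + (x + y) ≡⟨ sym (ℕ.+-assoc (z ∸ x) x y) ⟩
  z ∸ x + x + y   ≡⟨ cong (_+ y) (ℕ.m∸n+n≡m x≤z) ⟩
  z + y           ∎

sum-exchange : ∀ {k} {p m : Vec ℕ k} (n : Vec ℕ k) → p ≼ m →
  sum (exchange p n m) + sum p ≡ sum m + sum n
sum-exchange {p = []}    {[]}    []      []            = refl
sum-exchange {p = x ∷ p} {z ∷ m} (y ∷ n) (x≤z ∷ p≼m) = begin
  (z ∸ x + y + sum (exchange p n m)) + (x + sum p)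
    ≡⟨ +-interchange (z ∸ x + y) _ x _ ⟩
  (z ∸ x + y + x) + (sum (exchange p n m) + sum p)
    ≡⟨ cong₂ _+_ (∸+-exchange y x≤z) (sum-exchange n p≼m) ⟩
  (z + y) + (sum m + sum n)
    ≡⟨ +-interchange z y _ _ ⟩
  (z + sum m) + (y + sum n) ∎

eval-exchange : ∀ {k} {p m : Vec ℕ k} (n : Vec ℕ k) (a : Vecℤ k) → p ≼ m →
  eval (exchange p n m) a ℤ.+ eval p a ≡ eval m a ℤ.+ eval n a
eval-exchange {p = []}    {[]}    []      a []            = refl
eval-exchange {p = x ∷ p} {z ∷ m} (y ∷ n) a (x≤z ∷ p≼m) = begin
  (ℤ.+ (z ∸ x + y) ℤ.* c ℤ.+ eval (exchange p n m) a′) ℤ.+ (ℤ.+ x ℤ.* c ℤ.+ eval p a′)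
    ≡⟨ +ℤ-interchange (ℤ.+ (z ∸ x + y) ℤ.* c) _ _ _ ⟩
  (ℤ.+ (z ∸ x + y) ℤ.* c ℤ.+ ℤ.+ x ℤ.* c) ℤ.+ (eval (exchange p n m) a′ ℤ.+ eval p a′)
    ≡⟨ cong₂ ℤ._+_ coordinate (eval-exchange n a′ p≼m) ⟩
  (ℤ.+ z ℤ.* c ℤ.+ ℤ.+ y ℤ.* c) ℤ.+ (eval m a′ ℤ.+ eval n a′)
    ≡⟨ +ℤ-interchange (ℤ.+ z ℤ.* c) _ _ _ ⟩
  (ℤ.+ z ℤ.* c ℤ.+ eval m a′) ℤ.+ (ℤ.+ y ℤ.* c ℤ.+ eval n a′) ∎
  where
  c : ℤ
  c = a fzero
  a′ : Vecℤ _
  a′ = a ∘ fsuc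
  coordinate : ℤ.+ (z ∸ x + y) ℤ.* c ℤ.+ ℤ.+ x ℤ.* c ≡ ℤ.+ z ℤ.* c ℤ.+ ℤ.+ y ℤ.* c
  coordinate = begin
    ℤ.+ (z ∸ x + y) ℤ.* c ℤ.+ ℤ.+ x ℤ.* c ≡⟨ sym (ℤ.*-distribʳ-+ c (ℤ.+ (z ∸ x + y)) (ℤ.+ x)) ⟩
    (ℤ.+ (z ∸ x + y) ℤ.+ ℤ.+ x) ℤ.* c     ≡⟨ cong (ℤ._* c) (sym (ℤ.pos-+ (z ∸ x + y) x)) ⟩
    ℤ.+ (z ∸ x + y + x) ℤ.* c             ≡⟨ cong (λ s → ℤ.+ s ℤ.* c) (∸+-exchange y x≤z) ⟩
    ℤ.+ (z + y) ℤ.* c                     ≡⟨ cong (ℤ._* c) (ℤ.pos-+ z y) ⟩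
    (ℤ.+ z ℤ.+ ℤ.+ y) ℤ.* c               ≡⟨ ℤ.*-distribʳ-+ c (ℤ.+ z) (ℤ.+ y) ⟩
    ℤ.+ z ℤ.* c ℤ.+ ℤ.+ y ℤ.* c           ∎

dot : ∀ {k} → Vec ℕ k → Vec ℕ k → ℕ
dot p m = sum (zipWith _*_ p m)

sum≤dot-self : ∀ {k} (p : Vec ℕ k) → sum p ≤ dot p p
sum≤dot-self []            = z≤n
sum≤dot-self (zero  ∷ p)   = sum≤dot-self p
sum≤dot-self (suc x ∷ p)   = ℕ.+-mono-≤ (ℕ.m≤m*n (suc x) (suc x)) (sum≤dot-self p)

dot-exchange : ∀ {k} {p n m : Vec ℕ k} → p ≼ m → Pointwise (λ x y → x * y ≡ 0) p n →
  dot p (exchange p n m) + dot p p ≡ dot p m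
dot-exchange {p = []}    {[]}    {[]}    []            []          = refl
dot-exchange {p = x ∷ p} {y ∷ n} {z ∷ m} (x≤z ∷ p≼m) (xy≡0 ∷ pn≡0) = begin
  (x * (z ∸ x + y) + dot p (exchange p n m)) + (x * x + dot p p)
    ≡⟨ +-interchange (x * (z ∸ x + y)) _ _ _ ⟩
  (x * (z ∸ x + y) + x * x) + (dot p (exchange p n m) + dot p p)
    ≡⟨ cong₂ _+_ coordinate (dot-exchange p≼m pn≡0) ⟩
  x * z + dot p m ∎
  where
  coordinate : x * (z ∸ x + y) + x * x ≡ x * z
  coordinate = begin
    x * (z ∸ x + y) + x * x ≡⟨ sym (ℕ.*-distribˡ-+ x (z ∸ x + y) x) ⟩
    x * (z ∸ x + y + x)     ≡⟨ cong (x *_) (∸+-exchange y x≤z) ⟩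
    x * (z + y)             ≡⟨ ℕ.*-distribˡ-+ x z y ⟩
    x * z + x * y           ≡⟨ cong (x * z +_) xy≡0 ⟩
    x * z + 0               ≡⟨ ℕ.+-identityʳ (x * z) ⟩
    x * z                   ∎

-- Each trade of p for n lowers dot p m by dot p p ≥ 1.
exchange-reduce : ∀ {k} (a : Vecℤ k) {p n : Vec ℕ k} →
  sum p ≡ sum n → eval p a ≡ eval n a → Pointwise (λ x y → x * y ≡ 0) p n → 1 ≤ sum p →
  ∀ m → ∃ λ r → sum r ≡ sum m × ¬ p ≼ r × eval r a ≡ eval m a
exchange-reduce a {p} {n} sum≡ eval≡ pn≡0 1≤sum-p m = go (suc (dot p m)) m ℕ.≤-refl
  where
  decreasing : ∀ {fuel m} → p ≼ m → dot p m < suc fuel → dot p (exchange p n m) < fuel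
  decreasing p≼m dot<suc-fuel = ℕ.<-≤-trans
    (ℕ.m<m+n _ (ℕ.≤-trans 1≤sum-p (sum≤dot-self p)))
    (ℕ.≤-trans (ℕ.≤-reflexive (dot-exchange p≼m pn≡0)) (ℕ.≤-pred dot<suc-fuel))
  sum-preserved : ∀ {m} → p ≼ m → sum (exchange p n m) ≡ sum m
  sum-preserved {m} p≼m = ℕ.+-cancelʳ-≡ _ _ _ (trans (sum-exchange n p≼m) (cong (sum m +_) (sym sum≡)))
  eval-preserved : ∀ {m} → p ≼ m → eval (exchange p n m) a ≡ eval m a
  eval-preserved {m} p≼m = +ℤ-cancelʳ _ _ _
    (trans (eval-exchange n a p≼m) (cong (λ e → eval m a ℤ.+ e) (sym eval≡)))
  go : ∀ fuel m → dot p m < fuel → ∃ λ r → sum r ≡ sum m × ¬ p ≼ r × eval r a ≡ eval m a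
  go (suc fuel) m dot<fuel with p ≼? m
  ... | no  p⋠m = m , refl , p⋠m , refl
  ... | yes p≼m with go fuel (exchange p n m) (decreasing p≼m dot<fuel)
  ...   | r , sum-r≡ , p⋠r , eval-r≡ =
    r , trans sum-r≡ (sum-preserved p≼m) , p⋠r , trans eval-r≡ (eval-preserved p≼m)

-- Division with remainder: for q = ⌊-r₀/r₁⌋ the vector d - q v is a lattice vector with
-- r₁ (d - q v) = ρ v, 0 ≤ ρ < ∣r₁∣, which is too short to be nonzero.
dependent⇒multiple : ∀ {k} {a v d : Vecℤ k} {N} →
  InLattice a v → ‖ v ‖₁ ≡ N → 0 < N → (∀ w t → InLattice a w → w t ≢ 0ℤ → N ≤ ‖ w ‖₁) →
  InLattice a d → ∀ r₀ r₁ → r₁ ≢ 0ℤ → (∀ t → r₀ ℤ.* v t ℤ.+ r₁ ℤ.* d t ≡ 0ℤ) →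
  ∃ λ q → ∀ t → d t ≡ q ℤ.* v t
dependent⇒multiple {k} {a} {v} {d} {N} v∈L ‖v‖≡N 0<N minimal d∈L r₀ r₁ r₁≢0 dependent = q , d≡qv
  where
  instance
    r₁-nonZero : ℤ.NonZero r₁
    r₁-nonZero = ℤ.≢-nonZero r₁≢0
  q : ℤ
  q = (ℤ.- r₀) ℤ./ r₁
  ρ : ℕ
  ρ = (ℤ.- r₀) ℤ.% r₁
  w : Vecℤ k
  w t = d t ℤ.- q ℤ.* v t
  ρ≡ : ℤ.- r₀ ℤ.- q ℤ.* r₁ ≡ ℤ.+ ρ
  ρ≡ = begin
    ℤ.- r₀ ℤ.- q ℤ.* r₁                   ≡⟨ cong (λ s → s ℤ.- q ℤ.* r₁) (ℤ.a≡a%n+[a/n]*n (ℤ.- r₀) r₁) ⟩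
    ℤ.+ ρ ℤ.+ q ℤ.* r₁ ℤ.- q ℤ.* r₁       ≡⟨ ring (ℤ.+ ρ) (q ℤ.* r₁) ⟩
    ℤ.+ ρ                                 ∎
    where
    ring : ∀ x y → x ℤ.+ y ℤ.- y ≡ x
    ring = solve-∀
  r₁w≡ρv : ∀ t → r₁ ℤ.* w t ≡ ℤ.+ ρ ℤ.* v t
  r₁w≡ρv t = begin
    r₁ ℤ.* (d t ℤ.- q ℤ.* v t)                                  ≡⟨ ring r₀ r₁ (d t) (v t) q ⟩
    (r₀ ℤ.* v t ℤ.+ r₁ ℤ.* d t) ℤ.+ (ℤ.- r₀ ℤ.- q ℤ.* r₁) ℤ.* v t ≡⟨ cong₂ (λ x y → x ℤ.+ y ℤ.* v t) (dependent t) ρ≡ ⟩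
    0ℤ ℤ.+ ℤ.+ ρ ℤ.* v t                                        ≡⟨ ℤ.+-identityˡ _ ⟩
    ℤ.+ ρ ℤ.* v t                                               ∎
    where
    ring : ∀ r₀ r₁ d v q → r₁ ℤ.* (d ℤ.- q ℤ.* v) ≡ (r₀ ℤ.* v ℤ.+ r₁ ℤ.* d) ℤ.+ (ℤ.- r₀ ℤ.- q ℤ.* r₁) ℤ.* v
    ring = solve-∀
  w-zero : ∀ t → w t ≡ 0ℤ
  w-zero t with w t ℤ.≟ 0ℤ
  ... | yes wt≡0 = wt≡0
  ... | no  wt≢0 = ⊥-elim (ℕ.<-irrefl (sym ∣r₁∣‖w‖≡ρN) (ℕ.<-≤-trans ρN<∣r₁∣N ∣r₁∣N≤∣r₁∣‖w‖))
    where
    ∣r₁∣‖w‖≡ρN : ∣ r₁ ∣ * ‖ w ‖₁ ≡ ρ * N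
    ∣r₁∣‖w‖≡ρN = begin
      ∣ r₁ ∣ * ‖ w ‖₁                  ≡⟨ ‖*‖₁ r₁ w ⟨
      ‖ (λ t → r₁ ℤ.* w t) ‖₁          ≡⟨ Σℕ-cong (cong ∣_∣ ∘ r₁w≡ρv) ⟩
      ‖ (λ t → ℤ.+ ρ ℤ.* v t) ‖₁       ≡⟨ ‖*‖₁ (ℤ.+ ρ) v ⟩
      ρ * ‖ v ‖₁                       ≡⟨ cong (ρ *_) ‖v‖≡N ⟩
      ρ * N                            ∎
    ρN<∣r₁∣N : ρ * N < ∣ r₁ ∣ * N
    ρN<∣r₁∣N = ℕ.*-monoˡ-< N (ℤ.n%d<d (ℤ.- r₀) r₁)
      where instance
        N-nonZero : NonZero N
        N-nonZero = >-nonZero 0<N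
    ∣r₁∣N≤∣r₁∣‖w‖ : ∣ r₁ ∣ * N ≤ ∣ r₁ ∣ * ‖ w ‖₁
    ∣r₁∣N≤∣r₁∣‖w‖ = ℕ.*-monoʳ-≤ ∣ r₁ ∣ (minimal w t (InLattice-sub-* a d v q d∈L v∈L) wt≢0)
  d≡qv : ∀ t → d t ≡ q ℤ.* v t
  d≡qv t = ℤ.i-j≡0⇒i≡j (d t) (q ℤ.* v t) (w-zero t)

pair : ∀ {k} → Vecℤ k → Vecℤ k → Fin 2 → Vecℤ k
pair v d fzero    = v
pair v d (fsuc _) = d

length-filter+length-filter-∁ : ∀ {A : Set} {P : A → Set} (P? : ∀ x → Dec (P x)) xs →
  length (filter P? xs) + length (filter (¬? ∘ P?) xs) ≡ length xs
length-filter+length-filter-∁ P? []       = refl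
length-filter+length-filter-∁ P? (x ∷ xs) with P? x
... | yes _ = cong suc (length-filter+length-filter-∁ P? xs)
... | no  _ = trans (ℕ.+-suc _ _) (cong suc (length-filter+length-filter-∁ P? xs))

infixl 6 _+ᵥ_ _∸ᵥ_

_+ᵥ_ _∸ᵥ_ : ∀ {k} → Vec ℕ k → Vec ℕ k → Vec ℕ k
_+ᵥ_ = zipWith _+_
_∸ᵥ_ = zipWith _∸_

+ᵥ-∸ᵥ : ∀ {k} {p m : Vec ℕ k} → p ≼ m → p +ᵥ (m ∸ᵥ p) ≡ m
+ᵥ-∸ᵥ []            = refl
+ᵥ-∸ᵥ (x≤z ∷ p≼m) = cong₂ _∷_ (ℕ.m+[n∸m]≡n x≤z) (+ᵥ-∸ᵥ p≼m)

sum-+ᵥ : ∀ {k} (p m : Vec ℕ k) → sum (p +ᵥ m) ≡ sum p + sum m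
sum-+ᵥ []      []      = refl
sum-+ᵥ (x ∷ p) (y ∷ m) = trans (cong (x + y +_) (sum-+ᵥ p m)) (+-interchange x y (sum p) (sum m))

≼-+ᵥ : ∀ {k} (p m : Vec ℕ k) → p ≼ p +ᵥ m
≼-+ᵥ []      []      = []
≼-+ᵥ (x ∷ p) (y ∷ m) = ℕ.m≤m+n x y ∷ ≼-+ᵥ p m

+ᵥ-cancelˡ : ∀ {k} (p : Vec ℕ k) {m m′} → p +ᵥ m ≡ p +ᵥ m′ → m ≡ m′
+ᵥ-cancelˡ []      {[]}    {[]}      _ = refl
+ᵥ-cancelˡ (x ∷ p) {y ∷ m} {y′ ∷ m′} eq =
  cong₂ _∷_ (ℕ.+-cancelˡ-≡ x y y′ (∷-injectiveˡ eq)) (+ᵥ-cancelˡ p (∷-injectiveʳ eq))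

length-dominating : ∀ {k h} (p : Vec ℕ k) → sum p ≤ h →
  length (filter (p ≼?_) (compositions k h)) ≡ length (compositions k (h ∸ sum p))
length-dominating {k} {h} p ∣p∣≤h = trans
  (↭-length (∼bag⇒↭ (unique∧set⇒bag (Unique.filter⁺ (p ≼?_) (compositions-unique k h))
                                     (Unique.map⁺ (+ᵥ-cancelˡ p) (compositions-unique k (h ∸ sum p)))
                                     (mk⇔ to from))))
  (length-map (p +ᵥ_) (compositions k (h ∸ sum p)))
  where
  to : ∀ {m} → m ∈ filter (p ≼?_) (compositions k h) → m ∈ map (p +ᵥ_) (compositions k (h ∸ sum p))
  to {m} m∈ with ∈-filter⁻ (p ≼?_) {xs = compositions k h} m∈
  ... | m∈′ , p≼m = subst (_∈ map (p +ᵥ_) _) (+ᵥ-∸ᵥ p≼m) (∈-map⁺ (p +ᵥ_) (∈-compositions sum≡))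
    where
    sum≡ : sum (m ∸ᵥ p) ≡ h ∸ sum p
    sum≡ = begin
      sum (m ∸ᵥ p)                   ≡⟨ ℕ.m+n∸m≡n (sum p) _ ⟨
      sum p + sum (m ∸ᵥ p) ∸ sum p   ≡⟨ cong (_∸ sum p) (sum-+ᵥ p (m ∸ᵥ p)) ⟨
      sum (p +ᵥ (m ∸ᵥ p)) ∸ sum p    ≡⟨ cong (λ m′ → sum m′ ∸ sum p) (+ᵥ-∸ᵥ p≼m) ⟩
      sum m ∸ sum p                  ≡⟨ cong (_∸ sum p) (sum-compositions k h m∈′) ⟩
      h ∸ sum p                      ∎
  from : ∀ {m} → m ∈ map (p +ᵥ_) (compositions k (h ∸ sum p)) → m ∈ filter (p ≼?_) (compositions k h)
  from m∈ with ∈-map⁻ (p +ᵥ_) m∈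
  ... | y , y∈ , refl = ∈-filter⁺ (p ≼?_) (∈-compositions sum≡) (≼-+ᵥ p y)
    where
    sum≡ : sum (p +ᵥ y) ≡ h
    sum≡ = trans (sum-+ᵥ p y) (trans (cong (sum p +_) (sum-compositions k _ y∈)) (ℕ.m+[n∸m]≡n ∣p∣≤h))

length-nondominating : ∀ {k h} (p : Vec ℕ k) → sum p ≤ h →
  length (filter (¬? ∘ (p ≼?_)) (compositions k h)) ≡ length (compositions k h) ∸ length (compositions k (h ∸ sum p))
length-nondominating {k} {h} p ∣p∣≤h = begin
  length (filter (¬? ∘ (p ≼?_)) (compositions k h))
    ≡⟨ ℕ.m+n∸m≡n (length (filter (p ≼?_) (compositions k h))) _ ⟨
  length (filter (p ≼?_) (compositions k h)) + length (filter (¬? ∘ (p ≼?_)) (compositions k h)) ∸ length (filter (p ≼?_) (compositions k h))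
    ≡⟨ cong₂ _∸_ (length-filter+length-filter-∁ (p ≼?_) (compositions k h)) (length-dominating p ∣p∣≤h) ⟩
  length (compositions k h) ∸ length (compositions k (h ∸ sum p)) ∎

-- The range h₁ ≤ h < h₂

module MinimalVector {k} (a : Vecℤ k) {h₁} (sm₁ : IsSuccMin a 1 (2 * h₁)) where

  v : Vecℤ k
  v = proj₁ (proj₁ sm₁) fzero

  v∈L : InLattice a v
  v∈L = proj₁ (proj₂ (proj₂ (proj₁ sm₁))) fzero

  minimal : ∀ w t → InLattice a w → w t ≢ 0ℤ → 2 * h₁ ≤ ‖ w ‖₁
  minimal w t w∈L wt≢0 =
    proj₂ sm₁ _ ((λ _ → w) , single-linIndep w t wt≢0 , (λ _ → w∈L) , λ _ → ℕ.≤-refl)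

  v-nonzero : ∃ λ t → v t ≢ 0ℤ
  v-nonzero = Fin.¬∀⟶∃¬ k _ (λ t → v t ℤ.≟ 0ℤ) v≢0
    where
    v≢0 : ¬ (∀ t → v t ≡ 0ℤ)
    v≢0 v≡0 with proj₁ (proj₂ (proj₁ sm₁)) (λ _ → 1ℤ)
                   (λ t → trans (ℤ.+-identityʳ _) (trans (ℤ.*-identityˡ (v t)) (v≡0 t))) fzero
    ... | ()

  ‖v‖₁≡2h₁ : ‖ v ‖₁ ≡ 2 * h₁
  ‖v‖₁≡2h₁ = ℕ.≤-antisym (proj₂ (proj₂ (proj₂ (proj₁ sm₁))) fzero)
                         (minimal v (proj₁ v-nonzero) v∈L (proj₂ v-nonzero))

  0<2h₁ : 0 < 2 * h₁
  0<2h₁ = subst (0 <_) ‖v‖₁≡2h₁ (0<‖‖₁ v _ (proj₂ v-nonzero))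

  p n : Vec ℕ k
  p = posParts v
  n = negParts v

  eval-p≡eval-n : ∀ c → v · c ≡ 0ℤ → eval p c ≡ eval n c
  eval-p≡eval-n c v·c≡0 = ℤ.i-j≡0⇒i≡j _ _ (trans (sym (·-posParts-negParts v c)) v·c≡0)

  sum-p≡sum-n : sum p ≡ sum n
  sum-p≡sum-n = ℤ.+-injective (trans (sym (eval-𝟙 p)) (trans (eval-p≡eval-n 𝟙 (proj₁ v∈L)) (eval-𝟙 n)))

  sum-p≡h₁ : sum p ≡ h₁
  sum-p≡h₁ = ℕ.*-cancelˡ-≡ (sum p) h₁ 2 (begin
    2 * sum p     ≡⟨ cong (sum p +_) (ℕ.+-identityʳ (sum p)) ⟩
    sum p + sum p ≡⟨ cong (sum p +_) sum-p≡sum-n ⟩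
    sum p + sum n ≡⟨ ‖‖₁≡sum-posParts+sum-negParts v ⟨
    ‖ v ‖₁        ≡⟨ ‖v‖₁≡2h₁ ⟩
    2 * h₁        ∎)

  ¬multiple⇒linIndep : ∀ {d} → InLattice a d → ¬ (∃ λ q → ∀ t → d t ≡ q ℤ.* v t) → LinIndep (pair v d)
  ¬multiple⇒linIndep {d} d∈L ¬multiple r r·pair≡0 = r≡0
    where
    dependent : ∀ t → r fzero ℤ.* v t ℤ.+ r (fsuc fzero) ℤ.* d t ≡ 0ℤ
    dependent t = trans (cong (λ e → r fzero ℤ.* v t ℤ.+ e) (sym (ℤ.+-identityʳ _))) (r·pair≡0 t)
    r₁≡0 : r (fsuc fzero) ≡ 0ℤ
    r₁≡0 with r (fsuc fzero) ℤ.≟ 0ℤ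
    ... | yes r₁≡0 = r₁≡0
    ... | no  r₁≢0 = ⊥-elim (¬multiple
      (dependent⇒multiple v∈L ‖v‖₁≡2h₁ 0<2h₁ minimal d∈L (r fzero) _ r₁≢0 dependent))
    r≡0 : ∀ j → r j ≡ 0ℤ
    r≡0 fzero        = single-linIndep v (proj₁ v-nonzero) (proj₂ v-nonzero) (λ _ → r fzero)
      (λ t → subst (λ r₁ → r fzero ℤ.* v t ℤ.+ r₁ ℤ.* d t ≡ 0ℤ) r₁≡0 (dependent t)) fzero
    r≡0 (fsuc fzero) = r₁≡0

  distinct : ∀ {h h₂} → IsSuccMin a 2 (2 * h₂) → h₁ ≤ h → h < h₂ → ∀ {m m′} →
    sum m ≡ h → sum m′ ≡ h → ¬ p ≼ m → ¬ p ≼ m′ → m ≢ m′ → eval m a ≢ eval m′ a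
  distinct {h} (_ , minimal₂) h₁≤h h<h₂ {m} {m′} sum≡ sum′≡ p⋠m p⋠m′ m≢m′ eval≡ = multiple ¬multiple
    where
    d : Vecℤ k
    d = diff m m′
    d∈L : InLattice a d
    d∈L = diff-InLattice a m m′ (trans sum≡ (sym sum′≡)) eval≡
    -- Constructively the second minimum only refutes that (v, d) is independent.
    multiple : ¬ ¬ (∃ λ q → ∀ t → d t ≡ q ℤ.* v t)
    multiple ¬mult = ℕ.<⇒≱ (ℕ.*-monoʳ-< 2 h<h₂)
      (minimal₂ (2 * h) (pair v d , ¬multiple⇒linIndep d∈L ¬mult , (λ { fzero → v∈L ; (fsuc _) → d∈L }) , norms))
      where
      norms : ∀ j → ‖ pair v d j ‖₁ ≤ 2 * h
      norms fzero    = ℕ.≤-trans (ℕ.≤-reflexive ‖v‖₁≡2h₁) (ℕ.*-monoʳ-≤ 2 h₁≤h)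
      norms (fsuc _) = ‖diff‖₁≤2* m m′ sum≡ sum′≡
    ¬multiple : ¬ (∃ λ q → ∀ t → d t ≡ q ℤ.* v t)
    ¬multiple (ℤ.+ zero  , d≡0v) = let (t , dt≢0) = diff-nonzero m≢m′ in dt≢0 (d≡0v t)
    ¬multiple (ℤ.+ suc q , d≡qv) = p⋠m (multiple⇒posParts≼ v m m′ q d≡qv)
    ¬multiple (-[1+ q ]  , d≡qv) = p⋠m′ (multiple⇒posParts≼ v m′ m q (λ t →
      trans (diff-swap m m′ t) (trans (cong ℤ.-_ (d≡qv t)) (ℤ.neg-distribˡ-* -[1+ q ] (v t)))))

  card-between : ∀ {h h₂} → IsSuccMin a 2 (2 * h₂) → h₁ ≤ h → h < h₂ →
    HasCard (InSumset a h) (length (filter (¬? ∘ (p ≼?_)) (compositions k h)))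
  card-between {h} sm₂ h₁≤h h<h₂ = hasCard-image (λ m → eval m a) nondominating
    (Unique.filter⁺ (¬? ∘ (p ≼?_)) (compositions-unique k h)) injective InSumset⇔nondominating
    where
    nondominating : List (Vec ℕ k)
    nondominating = filter (¬? ∘ (p ≼?_)) (compositions k h)
    injective : ∀ {m m′} → m ∈ nondominating → m′ ∈ nondominating → m ≢ m′ → eval m a ≢ eval m′ a
    injective m∈ m′∈ =
      let (m∈c , p⋠m) = ∈-filter⁻ (¬? ∘ (p ≼?_)) {xs = compositions k h} m∈
          (m′∈c , p⋠m′) = ∈-filter⁻ (¬? ∘ (p ≼?_)) {xs = compositions k h} m′∈
      in distinct sm₂ h₁≤h h<h₂ (sum-compositions k h m∈c) (sum-compositions k h m′∈c) p⋠m p⋠m′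
    reduce : ∀ m → ∃ λ r → sum r ≡ sum m × ¬ p ≼ r × eval r a ≡ eval m a
    reduce = exchange-reduce a sum-p≡sum-n (eval-p≡eval-n a (proj₂ v∈L)) (posParts*negParts≡0 v)
      (subst (1 ≤_) (sym sum-p≡h₁) (positive-half h₁ 0<2h₁))
    InSumset⇔nondominating : ∀ z → InSumset a h z ⇔ (∃ λ m → m ∈ nondominating × z ≡ eval m a)
    InSumset⇔nondominating z = mk⇔ to from
      where
      to : InSumset a h z → ∃ λ m → m ∈ nondominating × z ≡ eval m a
      to z∈hA with Equivalence.to (InSumset⇔composition a h z) z∈hA
      ... | m , m∈ , z≡ with reduce m
      ...   | r , sum-r≡ , p⋠r , eval-r≡ =
        r , ∈-filter⁺ (¬? ∘ (p ≼?_)) (∈-compositions (trans sum-r≡ (sum-compositions k h m∈))) p⋠r ,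
        trans z≡ (sym eval-r≡)
      from : (∃ λ m → m ∈ nondominating × z ≡ eval m a) → InSumset a h z
      from (m , m∈ , z≡) = Equivalence.from (InSumset⇔composition a h z)
        (m , proj₁ (∈-filter⁻ (¬? ∘ (p ≼?_)) {xs = compositions k h} m∈) , z≡)

theorem1 : (k : ℕ) → 4 ≤ k → (a : Fin k → ℤ) → Injective _≡_ _≡_ a →
    (h₁ h₂ : ℕ) → IsSuccMin a 1 (2 * h₁) → IsSuccMin a 2 (2 * h₂) →
    ((h : ℕ) → 1 ≤ h → h < h₁ →
      HasCard (InSumset a h) ((h + k ∸ 1) C (k ∸ 1)))
    × ((h : ℕ) → h₁ ≤ h → h < h₂ →
      HasCard (InSumset a h) (((h + k ∸ 1) C (k ∸ 1)) ∸ ((h ∸ h₁ + k ∸ 1) C (k ∸ 1))))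
theorem1 (suc k) _ a _ h₁ h₂ sm₁ sm₂ = below , between
  where
  open MinimalVector a {h₁} sm₁ using (p; sum-p≡h₁; card-between)
  count : ∀ h → length (compositions (suc k) h) ≡ (h + suc k ∸ 1) C (suc k ∸ 1)
  count h = trans (length-compositions k h) (cong (λ s → (s ∸ 1) C k) (sym (ℕ.+-suc h k)))
  below : ∀ h → 1 ≤ h → h < h₁ → HasCard (InSumset a h) ((h + suc k ∸ 1) C (suc k ∸ 1))
  below h _ h<h₁ = subst (HasCard (InSumset a h)) (count h) (card-below-h₁ a sm₁ h<h₁)
  between : ∀ h → h₁ ≤ h → h < h₂ →
    HasCard (InSumset a h) (((h + suc k ∸ 1) C (suc k ∸ 1)) ∸ ((h ∸ h₁ + suc k ∸ 1) C (suc k ∸ 1)))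
  between h h₁≤h h<h₂ = subst (HasCard (InSumset a h))
    (begin
      length (filter (¬? ∘ (p ≼?_)) (compositions (suc k) h))
        ≡⟨ length-nondominating p (subst (_≤ h) (sym sum-p≡h₁) h₁≤h) ⟩
      length (compositions (suc k) h) ∸ length (compositions (suc k) (h ∸ sum p))
        ≡⟨ cong₂ _∸_ (count h) (trans (cong (length ∘ compositions (suc k) ∘ (h ∸_)) sum-p≡h₁) (count (h ∸ h₁))) ⟩
      ((h + suc k ∸ 1) C (suc k ∸ 1)) ∸ ((h ∸ h₁ + suc k ∸ 1) C (suc k ∸ 1)) ∎)
    (card-between sm₂ h₁≤h h<h₂)
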